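{- Let $A$ be a real $2\times 2$ matrix, $B$ a real $1\times 2$ row vector, and $\mathrm{NT}=\{\vec{x}\in\mathbb{R}^2 : BA^k\vec{x}>0 \ \forall k\ge 0\}$. Suppose $A$ has a positive eigenvalue $\lambda_1$ and a negative eigenvalue $\lambda_2$ with $\lambda_1<|\lambda_2|$. If there are eigenvectors $\vec{\beta_1}$, $\vec{\beta_2}$ for $\lambda_1$, $\lambda_2$ respectively, with $B\vec{\beta_1}>0$ and $B\vec{\beta_2}>0$, then $\mathrm{NT}=\{k\vec{\beta_1}: k>0\}$.
   Context: $\mathrm{NT}$ is the non-termination set of the loop $\mathrm{while}\ (B\vec{x}>0)\ \{\vec{x}:=A\vec{x}\}$. -}

module Defs where

open import Level using (0ℓ)
open import Data.Nat using (ℕ; zero; suc)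
open import Data.Product using (_×_; _,_; Σ; ∃; ∃-syntax)
open import Data.Sum using (_⊎_)
open import Relation.Binary.PropositionalEquality using (_≡_)
open import Relation.Nullary using (¬_)

-- An axiomatisation of the real numbers: a Dedekind-complete ordered field
-- (categorical: any two models are isomorphic to ℝ).  agda-stdlib has no reals,
-- so the theorem is stated for every such structure.
record RealField : Set₁ where
  infixl 6 _+_
  infixl 7 _*_
  infix  4 _<_
  field
    ℝ    : Set
    0ℝ 1ℝ : ℝ
    _+_ _*_ : ℝ → ℝ → ℝ
    -_   : ℝ → ℝ
    +-assoc : ∀ x y z → (x + y) + z ≡ x + (y + z)
    +-comm  : ∀ x y → x + y ≡ y + x
    +-idʳ   : ∀ x → x + 0ℝ ≡ x
    +-invʳ  : ∀ x → x + (- x) ≡ 0ℝ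
    *-assoc : ∀ x y z → (x * y) * z ≡ x * (y * z)
    *-comm  : ∀ x y → x * y ≡ y * x
    *-idʳ   : ∀ x → x * 1ℝ ≡ x
    distribˡ : ∀ x y z → x * (y + z) ≡ x * y + x * z
    0≢1     : ¬ (0ℝ ≡ 1ℝ)
    *-inv   : ∀ x → ¬ (x ≡ 0ℝ) → ∃[ y ] (x * y ≡ 1ℝ)
    _<_       : ℝ → ℝ → Set
    <-irrefl  : ∀ x → ¬ (x < x)
    <-trans   : ∀ {x y z} → x < y → y < z → x < z
    <-trichotomy : ∀ x y → x < y ⊎ x ≡ y ⊎ y < x
    +-mono-<  : ∀ {x y} z → x < y → x + z < y + z
    *-pos     : ∀ {x y} → 0ℝ < x → 0ℝ < y → 0ℝ < x * y
    sup : (P : ℝ → Set) → ∃[ x ] P x → ∃[ b ] (∀ x → P x → ¬ (b < x)) →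
          ∃[ s ] ((∀ x → P x → ¬ (s < x)) ×
                  (∀ b → (∀ x → P x → ¬ (b < x)) → ¬ (b < s)))

open RealField {{...}} public

module Linear {{R : RealField}} where

  Vec2 : Set
  Vec2 = ℝ × ℝ

  record Mat2 : Set where
    constructor mat
    field a₁₁ a₁₂ a₂₁ a₂₂ : ℝ

  Row2 : Set
  Row2 = ℝ × ℝ

  _·ᵥ_ : Mat2 → Vec2 → Vec2
  mat a b c d ·ᵥ (x , y) = (a * x + b * y , c * x + d * y)

  _⊙_ : Row2 → Vec2 → ℝ
  (b₁ , b₂) ⊙ (x , y) = b₁ * x + b₂ * y

  _•_ : ℝ → Vec2 → Vec2
  k • (x , y) = (k * x , k * y)

  0v : Vec2
  0v = (0ℝ , 0ℝ)

  _^_·_ : Mat2 → ℕ → Vec2 → Vec2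
  A ^ zero  · x = x
  A ^ suc k · x = A ·ᵥ (A ^ k · x)

  abs : ℝ → ℝ
  abs x with <-trichotomy x 0ℝ
  ... | Data.Sum.inj₁ _ = - x
  ... | Data.Sum.inj₂ _ = x

  IsEigenvector : Mat2 → ℝ → Vec2 → Set
  IsEigenvector A λ' v = ¬ (v ≡ 0v) × (A ·ᵥ v ≡ λ' • v)

  IsEigenvalue : Mat2 → ℝ → Set
  IsEigenvalue A λ' = ∃[ v ] IsEigenvector A λ' v

  -- non-termination set of  while (B x > 0) { x := A x }
  NT : Mat2 → Row2 → Vec2 → Set
  NT A B x = ∀ k → 0ℝ < B ⊙ (A ^ k · x)

open Linear public

module Submission where

-- Proof.  β₁ and β₂ are linearly independent (distinct eigenvalues), so every
-- x is a β₁ + b β₂ (Cramer's rule), and then  B Aᵏ x = a λ₁ᵏ Bβ₁ + b λ₂ᵏ Bβ₂.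
-- If b ≠ 0, choose the parity e of k with b λ₂ᵉ Bβ₂ < 0 (λ₂ < 0 makes both
-- signs available); along k = 2n + e the term (λ₂²)ⁿ dominates (λ₁²)ⁿ since
-- λ₁² < λ₂² (this is where completeness enters: powers of λ₂²/λ₁² > 1 are
-- unbounded), so B Aᵏ x < 0 eventually.  Hence x ∈ NT forces b = 0 and then
-- a > 0 (take k = 0); conversely every k β₁ with k > 0 stays in the loop.

open import Level using (0ℓ)
open import Data.Nat as ℕ using (ℕ; zero; suc)
open import Data.Product using (Σ; _×_; _,_; proj₁; proj₂)
open import Data.Sum using (_⊎_; inj₁; inj₂; [_,_]′)
open import Data.Maybe using (just; nothing)
open import Data.Empty using (⊥-elim)
open import Function.Bundles using (_⇔_; mk⇔; Equivalence)
open import Relation.Nullary using (¬_; yes)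
open import Relation.Binary.Definitions using (WeaklyDecidable)
open import Relation.Binary.PropositionalEquality as ≡ using (_≡_)
open import Algebra.Bundles using (RawRing; CommutativeRing)
open import Algebra.Solver.Ring.AlmostCommutativeRing
  using (fromCommutativeRing; _-Raw-AlmostCommutative⟶_)
import Algebra.Solver.Ring

-- An integer is represented by
-- a pair (p , n) of naturals standing for p - n, kept in the normal form
-- where one of the two is zero, so that equal integers are syntactically
-- equal and the coefficient test is decidable.  (ℝ itself cannot serve as the
-- coefficient ring: equality of reals does not compute.)
module IntegerCoefficientSolver {c ℓ} (R : CommutativeRing c ℓ) where
  open CommutativeRing R
  open import Relation.Binary.Reasoning.Setoid setoid
  open import Algebra.Properties.Ring ring
    using (-‿+-comm; ⁻¹-anti-homo‿-; x[y-z]≈xy-xz; [y-z]x≈yx-zx; -0#≈0#)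
  open import Algebra.Properties.CommutativeSemigroup +-commutativeSemigroup
    using (interchange)
  open import Algebra.Properties.Semiring.Mult semiring
    using (×-homo-+; ×1-homo-*) renaming (_×_ to _⨯_)

  Diff : Set
  Diff = ℕ × ℕ

  normal : ℕ → ℕ → Diff
  normal zero    n       = (0 , n)
  normal (suc p) zero    = (suc p , 0)
  normal (suc p) (suc n) = normal p n

  ⟦_⟧ : Diff → Carrier
  ⟦ p , n ⟧ = p ⨯ 1# - n ⨯ 1#

  cancel-summand : ∀ (z a b : Carrier) → (z + a) - (z + b) ≈ a - b
  cancel-summand z a b = begin
    (z + a) - (z + b)       ≈⟨ +-congˡ (-‿+-comm z b) ⟨
    (z + a) + (- z + - b)   ≈⟨ interchange z a (- z) (- b) ⟩
    (z - z) + (a - b)       ≈⟨ +-congʳ (-‿inverseʳ z) ⟩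
    0# + (a - b)            ≈⟨ +-identityˡ (a - b) ⟩
    a - b                   ∎

  normal-sound : ∀ (p n : ℕ) → ⟦ normal p n ⟧ ≈ p ⨯ 1# - n ⨯ 1#
  normal-sound zero    n       = refl
  normal-sound (suc p) zero    = refl
  normal-sound (suc p) (suc n) =
    trans (normal-sound p n) (sym (cancel-summand 1# (p ⨯ 1#) (n ⨯ 1#)))

  coefficients : RawRing _ _
  coefficients = record
    { Carrier = Diff ; _≈_ = _≡_
    ; _+_ = λ { (p , n) (p′ , n′) → normal (p ℕ.+ p′) (n ℕ.+ n′) }
    ; _*_ = λ { (p , n) (p′ , n′) →
                normal (p ℕ.* p′ ℕ.+ n ℕ.* n′) (p ℕ.* n′ ℕ.+ n ℕ.* p′) }
    ; -_ = λ { (p , n) → (n , p) }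
    ; 0# = (0 , 0) ; 1# = (1 , 0) }

  +-as-difference : ∀ (a b c d : Carrier) → (a + c) - (b + d) ≈ (a - b) + (c - d)
  +-as-difference a b c d = begin
    (a + c) - (b + d)      ≈⟨ +-congˡ (-‿+-comm b d) ⟨
    (a + c) + (- b + - d)  ≈⟨ interchange a c (- b) (- d) ⟩
    (a - b) + (c - d)      ∎

  *-as-difference : ∀ (a b c d : Carrier) →
    (a * c + b * d) - (a * d + b * c) ≈ (a - b) * (c - d)
  *-as-difference a b c d = sym (begin
    (a - b) * (c - d)                    ≈⟨ x[y-z]≈xy-xz (a - b) c d ⟩
    (a - b) * c - (a - b) * d            ≈⟨ distribute ⟩
    (a * c - b * c) - (a * d - b * d)    ≈⟨ +-congˡ (⁻¹-anti-homo‿- (a * d) (b * d)) ⟩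
    (a * c - b * c) + (b * d - a * d)    ≈⟨ interchange (a * c) (- (b * c)) (b * d) (- (a * d)) ⟩
    (a * c + b * d) + (- (b * c) - a * d) ≈⟨ +-congˡ (-‿+-comm (b * c) (a * d)) ⟩
    (a * c + b * d) - (b * c + a * d)    ≈⟨ +-congˡ (-‿cong (+-comm (b * c) (a * d))) ⟩
    (a * c + b * d) - (a * d + b * c)    ∎)
    where
    distribute : (a - b) * c - (a - b) * d ≈ (a * c - b * c) - (a * d - b * d)
    distribute = +-cong ([y-z]x≈yx-zx c a b) (-‿cong ([y-z]x≈yx-zx d a b))

  morphism : coefficients -Raw-AlmostCommutative⟶ fromCommutativeRing R
  morphism = record
    { ⟦_⟧ = ⟦_⟧
    ; +-homo = λ { (p , n) (p′ , n′) → begin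
        ⟦ normal (p ℕ.+ p′) (n ℕ.+ n′) ⟧
          ≈⟨ normal-sound (p ℕ.+ p′) (n ℕ.+ n′) ⟩
        (p ℕ.+ p′) ⨯ 1# - (n ℕ.+ n′) ⨯ 1#
          ≈⟨ +-cong (×-homo-+ 1# p p′) (-‿cong (×-homo-+ 1# n n′)) ⟩
        (p ⨯ 1# + p′ ⨯ 1#) - (n ⨯ 1# + n′ ⨯ 1#)
          ≈⟨ +-as-difference _ _ _ _ ⟩
        ⟦ p , n ⟧ + ⟦ p′ , n′ ⟧ ∎ }
    ; *-homo = λ { (p , n) (p′ , n′) → begin
        ⟦ normal (p ℕ.* p′ ℕ.+ n ℕ.* n′) (p ℕ.* n′ ℕ.+ n ℕ.* p′) ⟧
          ≈⟨ normal-sound (p ℕ.* p′ ℕ.+ n ℕ.* n′) (p ℕ.* n′ ℕ.+ n ℕ.* p′) ⟩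
        (p ℕ.* p′ ℕ.+ n ℕ.* n′) ⨯ 1# - (p ℕ.* n′ ℕ.+ n ℕ.* p′) ⨯ 1#
          ≈⟨ +-cong (embed-+* p p′ n n′) (-‿cong (embed-+* p n′ n p′)) ⟩
        (p ⨯ 1# * p′ ⨯ 1# + n ⨯ 1# * n′ ⨯ 1#) - (p ⨯ 1# * n′ ⨯ 1# + n ⨯ 1# * p′ ⨯ 1#)
          ≈⟨ *-as-difference _ _ _ _ ⟩
        ⟦ p , n ⟧ * ⟦ p′ , n′ ⟧ ∎ }
    ; -‿homo = λ { (p , n) → sym (⁻¹-anti-homo‿- (p ⨯ 1#) (n ⨯ 1#)) }
    ; 0-homo = -‿inverseʳ 0#
    ; 1-homo = trans (+-congˡ -0#≈0#) (trans (+-identityʳ _) (+-identityʳ 1#)) }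
    where
    embed-+* : ∀ (a b c d : ℕ) →
      (a ℕ.* b ℕ.+ c ℕ.* d) ⨯ 1# ≈ a ⨯ 1# * b ⨯ 1# + c ⨯ 1# * d ⨯ 1#
    embed-+* a b c d = trans (×-homo-+ 1# (a ℕ.* b) (c ℕ.* d)) (+-cong (×1-homo-* a b) (×1-homo-* c d))

  _≟-coefficient_ : WeaklyDecidable (λ x y → ⟦ x ⟧ ≈ ⟦ y ⟧)
  (p , n) ≟-coefficient (p′ , n′) with p ℕ.≟ p′ | n ℕ.≟ n′
  ... | yes ≡.refl | yes ≡.refl = just refl
  ... | _          | _          = nothing

  open Algebra.Solver.Ring coefficients (fromCommutativeRing R) morphism _≟-coefficient_
    public using (solve; _:=_; _:+_; _:*_; :-_; _:-_)

-- Defs is opened only here: its instance-overloaded field operators would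
-- clash with the operators of the abstract ring R above.
open import Defs
open ≡ using (refl; sym; trans; cong; cong₂; subst; subst₂)

module _ {{R : RealField}} where
  open ≡.≡-Reasoning

  commutativeRing : CommutativeRing 0ℓ 0ℓ
  commutativeRing = record
    { Carrier = ℝ ; _≈_ = _≡_ ; _+_ = _+_ ; _*_ = _*_ ; -_ = -_ ; 0# = 0ℝ ; 1# = 1ℝ
    ; isCommutativeRing = record
      { isRing = record
        { +-isAbelianGroup = record
          { isGroup = record
            { isMonoid = record
              { isSemigroup = record
                { isMagma = record { isEquivalence = ≡.isEquivalence ; ∙-cong = cong₂ _+_ }
                ; assoc = +-assoc }
              ; identity = (λ x → trans (+-comm 0ℝ x) (+-idʳ x)) , +-idʳ }
            ; inverse = (λ x → trans (+-comm (- x) x) (+-invʳ x)) , +-invʳ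
            ; ⁻¹-cong = cong -_ }
          ; comm = +-comm }
        ; *-cong = cong₂ _*_
        ; *-assoc = *-assoc
        ; *-identity = (λ x → trans (*-comm 1ℝ x) (*-idʳ x)) , *-idʳ
        ; distrib = distribˡ , λ x y z → trans (*-comm (y + z) x)
                      (trans (distribˡ x y z) (cong₂ _+_ (*-comm x y) (*-comm x z))) }
      ; *-comm = *-comm } }

  open IntegerCoefficientSolver commutativeRing using (solve; _:=_; _:+_; _:*_; :-_; _:-_)
  open CommutativeRing commutativeRing using (_-_; zeroˡ; zeroʳ; +-identityˡ; commutativeSemiring)
  open import Algebra.Properties.Ring (CommutativeRing.ring commutativeRing) using (x∙y⁻¹≈ε⇒x≈y)
  open import Algebra.Properties.CommutativeSemiring.Exp commutativeSemiring
    using (_^_; ^-homo-*; ^-assocʳ; ^-distrib-*)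

  <-asym : ∀ {x y : ℝ} → x < y → ¬ (y < x)
  <-asym {x} x<y y<x = <-irrefl x (<-trans x<y y<x)

  <⇒≢ : ∀ {x y : ℝ} → x < y → ¬ (x ≡ y)
  <⇒≢ {x} x<y refl = <-irrefl x x<y

  pos⇒≢0 : ∀ {x : ℝ} → 0ℝ < x → ¬ (x ≡ 0ℝ)
  pos⇒≢0 0<x x≡0 = <⇒≢ 0<x (sym x≡0)

  <⇒0<- : ∀ {x y : ℝ} → x < y → 0ℝ < y - x
  <⇒0<- {x} {y} x<y = subst (_< y - x) (+-invʳ x) (+-mono-< (- x) x<y)

  0<-⇒< : ∀ {x y : ℝ} → 0ℝ < y - x → x < y
  0<-⇒< {x} {y} 0<y-x = subst₂ _<_ (+-identityˡ x)
    (solve 2 (λ x y → (y :- x) :+ x := y) refl x y) (+-mono-< x 0<y-x)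

  neg⇒0<- : ∀ {x : ℝ} → x < 0ℝ → 0ℝ < - x
  neg⇒0<- {x} x<0 = subst (0ℝ <_) (+-identityˡ (- x)) (<⇒0<- x<0)

  0<-⇒neg : ∀ {x : ℝ} → 0ℝ < - x → x < 0ℝ
  0<-⇒neg {x} 0<-x = 0<-⇒< (subst (0ℝ <_) (sym (+-identityˡ (- x))) 0<-x)

  *-monoˡ-< : ∀ {z x y : ℝ} → 0ℝ < z → x < y → z * x < z * y
  *-monoˡ-< {z} {x} {y} 0<z x<y = 0<-⇒< (subst (0ℝ <_)
    (solve 3 (λ z x y → z :* (y :- x) := z :* y :- z :* x) refl z x y)
    (*-pos 0<z (<⇒0<- x<y)))

  *-neg-pos : ∀ {x y : ℝ} → x < 0ℝ → 0ℝ < y → x * y < 0ℝ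
  *-neg-pos {x} {y} x<0 0<y = 0<-⇒neg (subst (0ℝ <_)
    (solve 2 (λ x y → (:- x) :* y := :- (x :* y)) refl x y) (*-pos (neg⇒0<- x<0) 0<y))

  *-pos-neg : ∀ {x y : ℝ} → 0ℝ < x → y < 0ℝ → x * y < 0ℝ
  *-pos-neg {x} {y} 0<x y<0 = subst (_< 0ℝ) (*-comm y x) (*-neg-pos y<0 0<x)

  0<1 : 0ℝ < 1ℝ
  0<1 with <-trichotomy 0ℝ 1ℝ
  ... | inj₁ 0<1 = 0<1
  ... | inj₂ (inj₁ 0≡1) = ⊥-elim (0≢1 0≡1)
  ... | inj₂ (inj₂ 1<0) = ⊥-elim (<-asym 1<0 (subst (0ℝ <_) (*-idʳ 1ℝ) 0<1·1))
    where
    0<1·1 : 0ℝ < 1ℝ * 1ℝ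
    0<1·1 = subst (0ℝ <_) (solve 1 (λ x → (:- x) :* (:- x) := x :* x) refl 1ℝ)
              (*-pos (neg⇒0<- 1<0) (neg⇒0<- 1<0))

  pos-cancelˡ : ∀ {c a : ℝ} → 0ℝ < c → 0ℝ < c * a → 0ℝ < a
  pos-cancelˡ {c} {a} 0<c 0<ca with <-trichotomy a 0ℝ
  ... | inj₁ a<0 = ⊥-elim (<-asym 0<ca (*-pos-neg 0<c a<0))
  ... | inj₂ (inj₁ a≡0) = ⊥-elim (<⇒≢ 0<ca (sym (trans (cong (c *_) a≡0) (zeroʳ c))))
  ... | inj₂ (inj₂ 0<a) = 0<a

  inverse-pos : ∀ {x y : ℝ} → 0ℝ < x → x * y ≡ 1ℝ → 0ℝ < y
  inverse-pos 0<x xy≡1 = pos-cancelˡ 0<x (subst (0ℝ <_) (sym xy≡1) 0<1)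

  ≟0 : ∀ (x : ℝ) → x ≡ 0ℝ ⊎ ¬ (x ≡ 0ℝ)
  ≟0 x with <-trichotomy x 0ℝ
  ... | inj₁ x<0 = inj₂ (<⇒≢ x<0)
  ... | inj₂ (inj₁ x≡0) = inj₁ x≡0
  ... | inj₂ (inj₂ 0<x) = inj₂ (pos⇒≢0 0<x)

  *-cancelʳ : ∀ {x a b : ℝ} → ¬ (x ≡ 0ℝ) → a * x ≡ b * x → a ≡ b
  *-cancelʳ {x} {a} {b} x≢0 ax≡bx with *-inv x x≢0
  ... | x⁻¹ , xx⁻¹≡1 = begin
    a                  ≡⟨ sym (*-idʳ a) ⟩
    a * 1ℝ             ≡⟨ cong (a *_) (sym xx⁻¹≡1) ⟩
    a * (x * x⁻¹)      ≡⟨ sym (*-assoc a x x⁻¹) ⟩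
    (a * x) * x⁻¹      ≡⟨ cong (_* x⁻¹) ax≡bx ⟩
    (b * x) * x⁻¹      ≡⟨ *-assoc b x x⁻¹ ⟩
    b * (x * x⁻¹)      ≡⟨ cong (b *_) xx⁻¹≡1 ⟩
    b * 1ℝ             ≡⟨ *-idʳ b ⟩
    b                  ∎

  ^-pos : ∀ {x : ℝ} → 0ℝ < x → ∀ n → 0ℝ < x ^ n
  ^-pos 0<x zero    = 0<1
  ^-pos 0<x (suc n) = *-pos 0<x (^-pos 0<x n)

  IsPowerOf : ℝ → ℝ → Set
  IsPowerOf r y = Σ ℕ (λ n → y ≡ r ^ n)

  IsUpperBound : (ℝ → Set) → ℝ → Set
  IsUpperBound P b = ∀ y → P y → ¬ (b < y)

  -- For r > 1, dividing an upper bound s of the powers of r by r gives a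
  -- strictly smaller upper bound, so the powers have no least upper bound.
  smaller-bound : ∀ {r s : ℝ} → 1ℝ < r → IsUpperBound (IsPowerOf r) s →
    Σ ℝ (λ b → IsUpperBound (IsPowerOf r) b × b < s)
  smaller-bound {r} {s} 1<r s-bound = b , b-bound , b<s
    where
    0<r : 0ℝ < r
    0<r = <-trans 0<1 1<r
    r⁻¹ : ℝ
    r⁻¹ = proj₁ (*-inv r (pos⇒≢0 0<r))
    rr⁻¹≡1 : r * r⁻¹ ≡ 1ℝ
    rr⁻¹≡1 = proj₂ (*-inv r (pos⇒≢0 0<r))
    0<s : 0ℝ < s
    0<s with <-trichotomy 0ℝ s
    ... | inj₁ 0<s = 0<s
    ... | inj₂ (inj₁ 0≡s) = ⊥-elim (s-bound 1ℝ (0 , refl) (subst (_< 1ℝ) 0≡s 0<1))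
    ... | inj₂ (inj₂ s<0) = ⊥-elim (s-bound 1ℝ (0 , refl) (<-trans s<0 0<1))
    b : ℝ
    b = s * r⁻¹
    rb≡s : r * b ≡ s
    rb≡s = begin
      r * (s * r⁻¹)   ≡⟨ solve 3 (λ r s r⁻¹ → r :* (s :* r⁻¹) := s :* (r :* r⁻¹)) refl r s r⁻¹ ⟩
      s * (r * r⁻¹)   ≡⟨ cong (s *_) rr⁻¹≡1 ⟩
      s * 1ℝ          ≡⟨ *-idʳ s ⟩
      s               ∎
    b<s : b < s
    b<s = subst₂ _<_ (*-idʳ b) (trans (*-comm b r) rb≡s)
      (*-monoˡ-< (*-pos 0<s (inverse-pos 0<r rr⁻¹≡1)) 1<r)
    b-bound : IsUpperBound (IsPowerOf r) b
    b-bound y (n , refl) b<rⁿ =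
      s-bound (r ^ suc n) (suc n , refl) (subst (_< r ^ suc n) rb≡s (*-monoˡ-< 0<r b<rⁿ))

  ^-unbounded : ∀ {r M : ℝ} → 1ℝ < r → ¬ (∀ n → r ^ n < M)
  ^-unbounded {r} {M} 1<r bounded =
    let (s , s-bound , s-least) = sup (IsPowerOf r) (1ℝ , 0 , refl) (M , M-bound)
        (b , b-bound , b<s)     = smaller-bound 1<r s-bound
    in  s-least b b-bound b<s
    where
    M-bound : IsUpperBound (IsPowerOf r) M
    M-bound y (n , refl) = <-asym (bounded n)

  dominated : ∀ {α γ P Q : ℝ} → 0ℝ < α → α < γ → Q < 0ℝ →
    ¬ (∀ n → 0ℝ < α ^ n * P + γ ^ n * Q)
  dominated {α} {γ} {P} {Q} 0<α α<γ Q<0 positive = ^-unbounded 1<r bounded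
    where
    α⁻¹ : ℝ
    α⁻¹ = proj₁ (*-inv α (pos⇒≢0 0<α))
    αα⁻¹≡1 : α * α⁻¹ ≡ 1ℝ
    αα⁻¹≡1 = proj₂ (*-inv α (pos⇒≢0 0<α))
    q : ℝ
    q = proj₁ (*-inv (- Q) (pos⇒≢0 (neg⇒0<- Q<0)))
    -Qq≡1 : - Q * q ≡ 1ℝ
    -Qq≡1 = proj₂ (*-inv (- Q) (pos⇒≢0 (neg⇒0<- Q<0)))
    r : ℝ
    r = γ * α⁻¹
    1<r : 1ℝ < r
    1<r = subst₂ _<_ (trans (*-comm α⁻¹ α) αα⁻¹≡1) (*-comm α⁻¹ γ)
      (*-monoˡ-< (inverse-pos 0<α αα⁻¹≡1) α<γ)
    αr≡γ : α * r ≡ γ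
    αr≡γ = trans (solve 3 (λ α γ α⁻¹ → α :* (γ :* α⁻¹) := γ :* (α :* α⁻¹)) refl α γ α⁻¹)
                 (trans (cong (γ *_) αα⁻¹≡1) (*-idʳ γ))
    bounded : ∀ n → r ^ n < P * q
    bounded n = subst₂ _<_ cancel-q (*-comm q P)
      (*-monoˡ-< (inverse-pos (neg⇒0<- Q<0) -Qq≡1) below-P)
      where
      factored : α ^ n * P + γ ^ n * Q ≡ α ^ n * (P + r ^ n * Q)
      factored = begin
        α ^ n * P + γ ^ n * Q            ≡⟨ cong (λ t → α ^ n * P + t ^ n * Q) (sym αr≡γ) ⟩
        α ^ n * P + (α * r) ^ n * Q      ≡⟨ cong (λ t → α ^ n * P + t * Q) (^-distrib-* α r n) ⟩
        α ^ n * P + α ^ n * r ^ n * Q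
          ≡⟨ solve 4 (λ u v P Q → u :* P :+ u :* v :* Q := u :* (P :+ v :* Q)) refl (α ^ n) (r ^ n) P Q ⟩
        α ^ n * (P + r ^ n * Q)          ∎
      below-P : r ^ n * (- Q) < P
      below-P = 0<-⇒< (subst (0ℝ <_)
        (solve 3 (λ P v Q → P :+ v :* Q := P :- v :* (:- Q)) refl P (r ^ n) Q)
        (pos-cancelˡ (^-pos 0<α n) (subst (0ℝ <_) factored (positive n))))
      cancel-q : q * (r ^ n * (- Q)) ≡ r ^ n
      cancel-q = trans (solve 3 (λ q v m → q :* (v :* m) := v :* (m :* q)) refl q (r ^ n) (- Q))
                       (trans (cong (r ^ n *_) -Qq≡1) (*-idʳ (r ^ n)))

  ^-split : ∀ (x : ℝ) n e → x ^ (2 ℕ.* n ℕ.+ e) ≡ (x * x) ^ n * x ^ e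
  ^-split x n e = begin
    x ^ (2 ℕ.* n ℕ.+ e)          ≡⟨ ^-homo-* x (2 ℕ.* n) e ⟩
    x ^ (2 ℕ.* n) * x ^ e        ≡⟨ cong (_* x ^ e) (sym (^-assocʳ x 2 n)) ⟩
    (x * (x * 1ℝ)) ^ n * x ^ e   ≡⟨ cong (λ t → (x * t) ^ n * x ^ e) (*-idʳ x) ⟩
    (x * x) ^ n * x ^ e          ∎

  -- Let 0 < μ and μ² < ν².  If a μᵏ c₁ + b νᵏ c₂ > 0 for every k, then along
  -- the exponents 2n + e the second term dominates, so it is never negative.
  second-term-not-negative : ∀ {μ ν a b c₁ c₂ : ℝ} → 0ℝ < μ → μ * μ < ν * ν →
    (∀ k → 0ℝ < (a * μ ^ k) * c₁ + (b * ν ^ k) * c₂) →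
    ∀ e → ¬ ((b * ν ^ e) * c₂ < 0ℝ)
  second-term-not-negative {μ} {ν} {a} {b} {c₁} {c₂} 0<μ μμ<νν positive e negative =
    dominated (*-pos 0<μ 0<μ) μμ<νν negative
      (λ n → subst (0ℝ <_) (regroup n) (positive (2 ℕ.* n ℕ.+ e)))
    where
    regroup : ∀ n → (a * μ ^ (2 ℕ.* n ℕ.+ e)) * c₁ + (b * ν ^ (2 ℕ.* n ℕ.+ e)) * c₂
                  ≡ (μ * μ) ^ n * ((a * μ ^ e) * c₁) + (ν * ν) ^ n * ((b * ν ^ e) * c₂)
    regroup n = begin
      (a * μ ^ (2 ℕ.* n ℕ.+ e)) * c₁ + (b * ν ^ (2 ℕ.* n ℕ.+ e)) * c₂
        ≡⟨ cong₂ (λ s t → (a * s) * c₁ + (b * t) * c₂) (^-split μ n e) (^-split ν n e) ⟩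
      (a * ((μ * μ) ^ n * μ ^ e)) * c₁ + (b * ((ν * ν) ^ n * ν ^ e)) * c₂
        ≡⟨ solve 8 (λ a b c₁ c₂ s s′ t t′ → (a :* (s :* s′)) :* c₁ :+ (b :* (t :* t′)) :* c₂
                      := s :* ((a :* s′) :* c₁) :+ t :* ((b :* t′) :* c₂))
                   refl a b c₁ c₂ ((μ * μ) ^ n) (μ ^ e) ((ν * ν) ^ n) (ν ^ e) ⟩
      (μ * μ) ^ n * ((a * μ ^ e) * c₁) + (ν * ν) ^ n * ((b * ν ^ e) * c₂) ∎

  -- If moreover ν < 0 < c₂, both signs of b νᵉ c₂ are reachable
  -- (e = 0 and e = 1), so the coefficient b must vanish.
  second-coefficient-zero : ∀ {μ ν a b c₁ c₂ : ℝ} →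
    0ℝ < μ → ν < 0ℝ → μ * μ < ν * ν → 0ℝ < c₂ →
    (∀ k → 0ℝ < (a * μ ^ k) * c₁ + (b * ν ^ k) * c₂) → b ≡ 0ℝ
  second-coefficient-zero {μ} {ν} {a} {b} 0<μ ν<0 μμ<νν 0<c₂ positive with <-trichotomy b 0ℝ
  ... | inj₁ b<0 = ⊥-elim (second-term-not-negative 0<μ μμ<νν positive 0
          (*-neg-pos (subst (_< 0ℝ) (sym (*-idʳ b)) b<0) 0<c₂))
  ... | inj₂ (inj₁ b≡0) = b≡0
  ... | inj₂ (inj₂ 0<b) = ⊥-elim (second-term-not-negative 0<μ μμ<νν positive 1
          (*-neg-pos (*-pos-neg 0<b (subst (_< 0ℝ) (sym (*-idʳ ν)) ν<0)) 0<c₂))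

  abs-neg : ∀ {x : ℝ} → x < 0ℝ → abs x ≡ - x
  abs-neg {x} x<0 with <-trichotomy x 0ℝ
  ... | inj₁ _          = refl
  ... | inj₂ (inj₁ x≡0) = ⊥-elim (<⇒≢ x<0 x≡0)
  ... | inj₂ (inj₂ 0<x) = ⊥-elim (<-asym x<0 0<x)

  squares-< : ∀ {μ ν : ℝ} → 0ℝ < μ → ν < 0ℝ → μ < abs ν → μ * μ < ν * ν
  squares-< {μ} {ν} 0<μ ν<0 μ<|ν| = <-trans (*-monoˡ-< 0<μ μ<-ν)
    (subst₂ _<_ (*-comm (- ν) μ) (solve 1 (λ ν → (:- ν) :* (:- ν) := ν :* ν) refl ν)
      (*-monoˡ-< (neg⇒0<- ν<0) μ<-ν))
    where
    μ<-ν : μ < - ν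
    μ<-ν = subst (μ <_) (abs-neg ν<0) μ<|ν|

  infixl 6 _⊕_
  _⊕_ : Vec2 → Vec2 → Vec2
  (x , y) ⊕ (x′ , y′) = (x + x′ , y + y′)

  ·ᵥ-scale : ∀ (A : Mat2) (t : ℝ) (u : Vec2) → A ·ᵥ (t • u) ≡ t • (A ·ᵥ u)
  ·ᵥ-scale (mat a b c d) t (x , y) = cong₂ _,_ (row a b) (row c d)
    where
    row : ∀ (a b : ℝ) → a * (t * x) + b * (t * y) ≡ t * (a * x + b * y)
    row a b = solve 5 (λ a b t x y → a :* (t :* x) :+ b :* (t :* y) := t :* (a :* x :+ b :* y)) refl a b t x y

  ·ᵥ-additive : ∀ (A : Mat2) (u v : Vec2) → A ·ᵥ (u ⊕ v) ≡ A ·ᵥ u ⊕ A ·ᵥ v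
  ·ᵥ-additive (mat a b c d) (x , y) (x′ , y′) = cong₂ _,_ (row a b) (row c d)
    where
    row : ∀ (a b : ℝ) → a * (x + x′) + b * (y + y′) ≡ (a * x + b * y) + (a * x′ + b * y′)
    row a b = solve 6 (λ a b x y x′ y′ → a :* (x :+ x′) :+ b :* (y :+ y′)
                         := (a :* x :+ b :* y) :+ (a :* x′ :+ b :* y′)) refl a b x y x′ y′

  •-assoc : ∀ (s t : ℝ) (u : Vec2) → s • (t • u) ≡ (s * t) • u
  •-assoc s t (x , y) = cong₂ _,_ (sym (*-assoc s t x)) (sym (*-assoc s t y))

  •-comm : ∀ (s t : ℝ) (u : Vec2) → s • (t • u) ≡ t • (s • u)
  •-comm s t u = trans (•-assoc s t u) (trans (cong (_• u) (*-comm s t)) (sym (•-assoc t s u)))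

  ⊙-linear : ∀ (B : Row2) (a b : ℝ) (u v : Vec2) → B ⊙ (a • u ⊕ b • v) ≡ a * (B ⊙ u) + b * (B ⊙ v)
  ⊙-linear (b₁ , b₂) a b (x , y) (x′ , y′) =
    solve 8 (λ b₁ b₂ a b x y x′ y′ → b₁ :* (a :* x :+ b :* x′) :+ b₂ :* (a :* y :+ b :* y′)
               := a :* (b₁ :* x :+ b₂ :* y) :+ b :* (b₁ :* x′ :+ b₂ :* y′)) refl b₁ b₂ a b x y x′ y′

  without-second-vector : ∀ {a b : ℝ} {u v : Vec2} → b ≡ 0ℝ → a • u ⊕ b • v ≡ a • u
  without-second-vector {a} {b} {x , y} {x′ , y′} refl =
    cong₂ _,_ (vanish (a * x) x′) (vanish (a * y) y′)
    where
    vanish : ∀ (s t : ℝ) → s + 0ℝ * t ≡ s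
    vanish s t = trans (cong (s +_) (zeroˡ t)) (+-idʳ s)

  ^·-eigenbasis : ∀ {A : Mat2} {μ ν : ℝ} {u v : Vec2} →
    A ·ᵥ u ≡ μ • u → A ·ᵥ v ≡ ν • v → ∀ (a b : ℝ) k →
    A ^ k · (a • u ⊕ b • v) ≡ (a * μ ^ k) • u ⊕ (b * ν ^ k) • v
  ^·-eigenbasis {A} {μ} {ν} {u} {v} Au Av a b zero =
    cong₂ (λ s t → s • u ⊕ t • v) (sym (*-idʳ a)) (sym (*-idʳ b))
  ^·-eigenbasis {A} {μ} {ν} {u} {v} Au Av a b (suc k) = begin
    A ·ᵥ (A ^ k · (a • u ⊕ b • v))
      ≡⟨ cong (A ·ᵥ_) (^·-eigenbasis Au Av a b k) ⟩
    A ·ᵥ ((a * μ ^ k) • u ⊕ (b * ν ^ k) • v)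
      ≡⟨ ·ᵥ-additive A _ _ ⟩
    A ·ᵥ ((a * μ ^ k) • u) ⊕ A ·ᵥ ((b * ν ^ k) • v)
      ≡⟨ cong₂ _⊕_ (·ᵥ-scale A _ u) (·ᵥ-scale A _ v) ⟩
    (a * μ ^ k) • (A ·ᵥ u) ⊕ (b * ν ^ k) • (A ·ᵥ v)
      ≡⟨ cong₂ (λ s t → (a * μ ^ k) • s ⊕ (b * ν ^ k) • t) Au Av ⟩
    (a * μ ^ k) • (μ • u) ⊕ (b * ν ^ k) • (ν • v)
      ≡⟨ cong₂ _⊕_ (•-assoc _ μ u) (•-assoc _ ν v) ⟩
    ((a * μ ^ k) * μ) • u ⊕ ((b * ν ^ k) * ν) • v
      ≡⟨ cong₂ (λ s t → s • u ⊕ t • v) (step a μ) (step b ν) ⟩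
    (a * μ ^ suc k) • u ⊕ (b * ν ^ suc k) • v ∎
    where
    step : ∀ (c x : ℝ) → (c * x ^ k) * x ≡ c * (x * x ^ k)
    step c x = solve 3 (λ c x p → (c :* p) :* x := c :* (x :* p)) refl c x (x ^ k)

  trajectory : ∀ {A : Mat2} {B : Row2} {μ ν : ℝ} {u v : Vec2} →
    A ·ᵥ u ≡ μ • u → A ·ᵥ v ≡ ν • v → ∀ (a b : ℝ) k →
    B ⊙ (A ^ k · (a • u ⊕ b • v)) ≡ (a * μ ^ k) * (B ⊙ u) + (b * ν ^ k) * (B ⊙ v)
  trajectory {B = B} Au Av a b k =
    trans (cong (B ⊙_) (^·-eigenbasis Au Av a b k)) (⊙-linear B _ _ _ _)

  det : Vec2 → Vec2 → ℝ
  det (p , q) (p′ , q′) = p * q′ - q * p′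

  nonzero-coordinate : ∀ {x y : ℝ} → ¬ ((x , y) ≡ 0v) → ¬ (x ≡ 0ℝ) ⊎ ¬ (y ≡ 0ℝ)
  nonzero-coordinate {x} {y} xy≢0 with ≟0 x | ≟0 y
  ... | inj₂ x≢0 | _        = inj₁ x≢0
  ... | inj₁ x≡0 | inj₂ y≢0 = inj₂ y≢0
  ... | inj₁ x≡0 | inj₁ y≡0 = ⊥-elim (xy≢0 (cong₂ _,_ x≡0 y≡0))

  proportional : ∀ {p q p′ q′ i : ℝ} → p * i ≡ 1ℝ → p * q′ ≡ q * p′ →
    (p′ ≡ (p′ * i) * p) × (q′ ≡ (p′ * i) * q)
  proportional {p} {q} {p′} {q′} {i} pi≡1 cross =
    ( (begin
        p′              ≡⟨ sym (*-idʳ p′) ⟩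
        p′ * 1ℝ         ≡⟨ cong (p′ *_) (sym pi≡1) ⟩
        p′ * (p * i)    ≡⟨ solve 3 (λ p′ p i → p′ :* (p :* i) := (p′ :* i) :* p) refl p′ p i ⟩
        (p′ * i) * p    ∎)
    , (begin
        q′              ≡⟨ sym (*-idʳ q′) ⟩
        q′ * 1ℝ         ≡⟨ cong (q′ *_) (sym pi≡1) ⟩
        q′ * (p * i)    ≡⟨ solve 3 (λ q′ p i → q′ :* (p :* i) := (p :* q′) :* i) refl q′ p i ⟩
        (p * q′) * i    ≡⟨ cong (_* i) cross ⟩
        (q * p′) * i    ≡⟨ solve 3 (λ q p′ i → (q :* p′) :* i := (p′ :* i) :* q) refl q p′ i ⟩
        (p′ * i) * q    ∎) )

  parallel : ∀ {u v : Vec2} → ¬ (u ≡ 0v) → det u v ≡ 0ℝ → Σ ℝ (λ t → v ≡ t • u)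
  parallel {p , q} {p′ , q′} u≢0 det≡0 = [ via-p , via-q ]′ (nonzero-coordinate u≢0)
    where
    cross : p * q′ ≡ q * p′
    cross = x∙y⁻¹≈ε⇒x≈y _ _ det≡0
    via-p : ¬ (p ≡ 0ℝ) → Σ ℝ (λ t → (p′ , q′) ≡ t • (p , q))
    via-p p≢0 =
      let (i , pi≡1)   = *-inv p p≢0
          (p′≡ , q′≡) = proportional pi≡1 cross
      in  p′ * i , cong₂ _,_ p′≡ q′≡
    via-q : ¬ (q ≡ 0ℝ) → Σ ℝ (λ t → (p′ , q′) ≡ t • (p , q))
    via-q q≢0 =
      let (i , qi≡1)   = *-inv q q≢0
          (q′≡ , p′≡) = proportional qi≡1 (sym cross)
      in  q′ * i , cong₂ _,_ p′≡ q′≡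

  •-cancelʳ : ∀ {μ ν : ℝ} {v : Vec2} → ¬ (v ≡ 0v) → μ • v ≡ ν • v → μ ≡ ν
  •-cancelʳ v≢0 μv≡νv =
    [ (λ x≢0 → *-cancelʳ x≢0 (cong proj₁ μv≡νv))
    , (λ y≢0 → *-cancelʳ y≢0 (cong proj₂ μv≡νv)) ]′
      (nonzero-coordinate v≢0)

  eigenvectors-independent : ∀ {A : Mat2} {μ ν : ℝ} {u v : Vec2} → ¬ (μ ≡ ν) →
    IsEigenvector A μ u → IsEigenvector A ν v → ¬ (det u v ≡ 0ℝ)
  eigenvectors-independent {A} {μ} {ν} {u} {v} μ≢ν (u≢0 , Au) (v≢0 , Av) det≡0 =
    let (t , v≡tu) = parallel u≢0 det≡0
    in  μ≢ν (•-cancelʳ v≢0 (begin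
      μ • v            ≡⟨ cong (μ •_) v≡tu ⟩
      μ • (t • u)      ≡⟨ •-comm μ t u ⟩
      t • (μ • u)      ≡⟨ cong (t •_) Au ⟨
      t • (A ·ᵥ u)     ≡⟨ ·ᵥ-scale A t u ⟨
      A ·ᵥ (t • u)     ≡⟨ cong (A ·ᵥ_) v≡tu ⟨
      A ·ᵥ v           ≡⟨ Av ⟩
      ν • v            ∎))

  -- Cramer's rule: independent vectors form a basis of the plane
  decompose : ∀ {u v : Vec2} → ¬ (det u v ≡ 0ℝ) → ∀ x →
    Σ ℝ (λ a → Σ ℝ (λ b → x ≡ a • u ⊕ b • v))
  decompose {p₁ , q₁} {p₂ , q₂} det≢0 (x₁ , x₂) = a , b , cong₂ _,_ (sym first) (sym second)
    where
    D d : ℝ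
    D = det (p₁ , q₁) (p₂ , q₂)
    d = proj₁ (*-inv D det≢0)
    a b : ℝ
    a = (x₁ * q₂ - x₂ * p₂) * d
    b = (p₁ * x₂ - q₁ * x₁) * d
    unit : ∀ (x : ℝ) → x * (D * d) ≡ x
    unit x = trans (cong (x *_) (proj₂ (*-inv D det≢0))) (*-idʳ x)
    first : a * p₁ + b * p₂ ≡ x₁
    first = trans (solve 7 (λ x₁ x₂ p₁ q₁ p₂ q₂ d →
                     ((x₁ :* q₂ :- x₂ :* p₂) :* d) :* p₁ :+ ((p₁ :* x₂ :- q₁ :* x₁) :* d) :* p₂
                     := x₁ :* ((p₁ :* q₂ :- q₁ :* p₂) :* d)) refl x₁ x₂ p₁ q₁ p₂ q₂ d)
                  (unit x₁)
    second : a * q₁ + b * q₂ ≡ x₂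
    second = trans (solve 7 (λ x₁ x₂ p₁ q₁ p₂ q₂ d →
                      ((x₁ :* q₂ :- x₂ :* p₂) :* d) :* q₁ :+ ((p₁ :* x₂ :- q₁ :* x₁) :* d) :* q₂
                      := x₂ :* ((p₁ :* q₂ :- q₁ :* p₂) :* d)) refl x₁ x₂ p₁ q₁ p₂ q₂ d)
                   (unit x₂)

  NT-in-eigenbasis : ∀ {A : Mat2} {B : Row2} {μ ν : ℝ} {u v : Vec2} →
    A ·ᵥ u ≡ μ • u → A ·ᵥ v ≡ ν • v →
    0ℝ < μ → ν < 0ℝ → μ * μ < ν * ν → 0ℝ < B ⊙ u → 0ℝ < B ⊙ v →
    ∀ (a b : ℝ) → NT A B (a • u ⊕ b • v) ⇔ (b ≡ 0ℝ × 0ℝ < a)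
  NT-in-eigenbasis {A} {B} {μ} {ν} {u} {v} Au Av 0<μ ν<0 μμ<νν 0<Bu 0<Bv a b = mk⇔ escapes stays
    where
    without-second-term : ∀ k → b ≡ 0ℝ →
      (a * μ ^ k) * (B ⊙ u) + (b * ν ^ k) * (B ⊙ v) ≡ (a * μ ^ k) * (B ⊙ u)
    without-second-term k refl = begin
      (a * μ ^ k) * (B ⊙ u) + (0ℝ * ν ^ k) * (B ⊙ v)
        ≡⟨ cong (λ t → (a * μ ^ k) * (B ⊙ u) + t * (B ⊙ v)) (zeroˡ (ν ^ k)) ⟩
      (a * μ ^ k) * (B ⊙ u) + 0ℝ * (B ⊙ v)
        ≡⟨ cong ((a * μ ^ k) * (B ⊙ u) +_) (zeroˡ (B ⊙ v)) ⟩
      (a * μ ^ k) * (B ⊙ u) + 0ℝ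
        ≡⟨ +-idʳ _ ⟩
      (a * μ ^ k) * (B ⊙ u) ∎
    escapes : NT A B (a • u ⊕ b • v) → b ≡ 0ℝ × 0ℝ < a
    escapes nt = b≡0 , pos-cancelˡ 0<Bu (subst (0ℝ <_) first-term (positive 0))
      where
      positive : ∀ k → 0ℝ < (a * μ ^ k) * (B ⊙ u) + (b * ν ^ k) * (B ⊙ v)
      positive k = subst (0ℝ <_) (trajectory Au Av a b k) (nt k)
      b≡0 : b ≡ 0ℝ
      b≡0 = second-coefficient-zero 0<μ ν<0 μμ<νν 0<Bv positive
      first-term : (a * 1ℝ) * (B ⊙ u) + (b * 1ℝ) * (B ⊙ v) ≡ (B ⊙ u) * a
      first-term = trans (without-second-term 0 b≡0)
        (trans (*-comm _ (B ⊙ u)) (cong ((B ⊙ u) *_) (*-idʳ a)))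
    stays : b ≡ 0ℝ × 0ℝ < a → NT A B (a • u ⊕ b • v)
    stays (b≡0 , 0<a) k =
      subst (0ℝ <_) (sym (trans (trajectory Au Av a b k) (without-second-term k b≡0)))
        (*-pos (*-pos 0<a (^-pos 0<μ k)) 0<Bu)

lemma10 : {{R : RealField}} →
    (A : Mat2) (B : Row2) (λ₁ λ₂ : ℝ) (β₁ β₂ : Vec2) →
    IsEigenvalue A λ₁ → IsEigenvalue A λ₂ →
    0ℝ < λ₁ → λ₂ < 0ℝ → λ₁ < abs λ₂ →
    IsEigenvector A λ₁ β₁ → IsEigenvector A λ₂ β₂ →
    0ℝ < B ⊙ β₁ → 0ℝ < B ⊙ β₂ →
    ∀ x → NT A B x ⇔ (Σ ℝ (λ k → 0ℝ < k × x ≡ k • β₁))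
-- (the eigenvalue hypotheses are implied by the eigenvector ones and unused)
lemma10 A B λ₁ λ₂ β₁ β₂ _ _ 0<λ₁ λ₂<0 λ₁<|λ₂| eigen₁ eigen₂ 0<Bβ₁ 0<Bβ₂ x =
  mk⇔ NT⇒ray ray⇒NT
  where
  coordinates : ∀ (a b : ℝ) → NT A B (a • β₁ ⊕ b • β₂) ⇔ (b ≡ 0ℝ × 0ℝ < a)
  coordinates = NT-in-eigenbasis (proj₂ eigen₁) (proj₂ eigen₂) 0<λ₁ λ₂<0
    (squares-< 0<λ₁ λ₂<0 λ₁<|λ₂|) 0<Bβ₁ 0<Bβ₂
  λ₁≢λ₂ : ¬ (λ₁ ≡ λ₂)
  λ₁≢λ₂ λ₁≡λ₂ = <⇒≢ (<-trans λ₂<0 0<λ₁) (sym λ₁≡λ₂)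
  NT⇒ray : NT A B x → Σ ℝ (λ k → 0ℝ < k × x ≡ k • β₁)
  NT⇒ray nt =
    let (a , b , x≡) = decompose (eigenvectors-independent λ₁≢λ₂ eigen₁ eigen₂) x
        (b≡0 , 0<a)  = Equivalence.to (coordinates a b) (subst (NT A B) x≡ nt)
    in  a , 0<a , trans x≡ (without-second-vector b≡0)
  ray⇒NT : Σ ℝ (λ k → 0ℝ < k × x ≡ k • β₁) → NT A B x
  ray⇒NT (k , 0<k , refl) =
    subst (NT A B) (without-second-vector refl) (Equivalence.from (coordinates k 0ℝ) (refl , 0<k))
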